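{- Let $w$ be a word with $s_1(w)=s_2(w)=2$ (a 2FS square), and let $SQ_1^2$ (resp. $SQ_2^2$) be the longer of the two squares whose last occurrence in $w$ starts at location 1 (resp. 2). Then the occurrence of $SQ_2^2$ at location 2 ends after the occurrence of $SQ_1^2$ at location 1, i.e., $2|SQ_2|+1>2|SQ_1|$.
   Context: A square is a word $uu$ with $u$ nonempty; $u$ is its root. A square $uu$ occurs at location $k$ of $w=a_1\cdots a_n$ if $a_k\cdots a_{k+2|u|-1}=uu$. $s_k(w)$ is the number of distinct squares occurring at location $k$ of $w$ but at no location $k'>k$. It is known that $s_k(w)\le 2$. -}

module Defs where

open import Data.List using (List; []; _++_; length)
open import Data.Nat using (ℕ; suc; _<_; _∸_)
open import Data.Product using (Σ; _×_; ∃)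
open import Data.Sum using (_⊎_)
open import Relation.Binary.PropositionalEquality using (_≡_; _≢_)
open import Relation.Nullary using (¬_)

IsSquareWithRoot : {A : Set} → List A → List A → Set
IsSquareWithRoot x u = (u ≢ []) × (x ≡ u ++ u)

IsSquare : {A : Set} → List A → Set
IsSquare {A} x = Σ (List A) (IsSquareWithRoot x)

OccursAt : {A : Set} → List A → List A → ℕ → Set
OccursAt {A} x w k =
  (0 < k) × Σ (List A) (λ p → Σ (List A) (λ s → (length p ≡ k ∸ 1) × (w ≡ p ++ (x ++ s))))

LastOccursAt : {A : Set} → List A → List A → ℕ → Set
LastOccursAt x w k = OccursAt x w k × (∀ k' → k < k' → ¬ OccursAt x w k')

Counted : {A : Set} → List A → ℕ → List A → Set
Counted w k x = IsSquare x × LastOccursAt x w k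

s≡2 : {A : Set} → List A → ℕ → Set
s≡2 {A} w k =
  Σ (List A) λ x → Σ (List A) λ y →
    (x ≢ y) × Counted w k x × Counted w k y ×
    (∀ z → Counted w k z → (z ≡ x) ⊎ (z ≡ y))

LongestRootAt : {A : Set} → List A → ℕ → List A → Set
LongestRootAt {A} w k u =
  Counted w k (u ++ u) × (u ≢ []) ×
  (∀ v → IsSquareWithRoot (v ++ v) v → LastOccursAt (v ++ v) w k → length v Data.Nat.≤ length u)

-- Suppose |SQ₂| < |SQ₁| and let r r, t t with |r| < |t| be the two squares counted by s₂(w), so
-- that |t| ≤ |SQ₂| < |SQ₁|; let u = SQ₁. Read from location 2, w starts with r r and with t t,
-- while u u starts one letter earlier; we show that r r then occurs again further right,
-- contradicting the definition of s₂(w). If 2|r| < |u| it recurs |u| letters later. Otherwise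
-- write |t| = |r| + d and |u| = |t| + β: comparing r r and t t with u u gives the periods d + β
-- and β on overlapping windows, so by the Fine–Wilf theorem γ = gcd(d + β, β) is a period of
-- their common part. It spreads along d + β, β and |u| to all of u u but its first letter, and
-- as γ ≤ d, r r recurs γ letters later.
module Submission where

open import Data.Empty using (⊥-elim)
open import Data.List using (List; []; _∷_; _++_; length; take; drop)
open import Data.List.Properties using (length-++; length-take; length-drop; take++drop≡id)
open import Data.Maybe using (Maybe; just; nothing)
open import Data.Maybe.Properties using (just-injective)
open import Data.Nat
open import Data.Nat.Divisibility using (_∣_; ∣-antisym; ∣m∣n⇒∣m+n; ∣m+n∣m⇒∣n; ∣⇒≤)
open import Data.Nat.GCD
  using ( gcd; gcd-greatest; gcd[m,n]∣m; gcd[m,n]∣n; gcd-comm; gcd-identityˡ; gcd-identityʳ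
        ; gcd[m,n]≤n; gcd[m,n]≢0)
open import Data.Nat.Induction using (<-wellFounded)
open import Data.Nat.Properties
open import Data.Nat.Tactic.RingSolver
open import Data.Product using (∃-syntax; _×_; _,_; proj₁)
open import Data.Sum using (inj₁; inj₂)
open import Induction.WellFounded using (Acc; acc)
open import Relation.Binary.Definitions using (tri<; tri≈; tri>)
open import Relation.Binary.PropositionalEquality
open import Relation.Nullary using (yes; no)

open import Defs

HasPeriodOn : {B : Set} → (ℕ → B) → ℕ → ℕ → ℕ → Set
HasPeriodOn f lo hi p = ∀ k → lo ≤ k → k + p < hi → f k ≡ f (k + p)

m+n≤o⇒∃[k]m≤k×k+n≡o : ∀ {m n o} → m + n ≤ o → ∃[ k ] m ≤ k × k + n ≡ o
m+n≤o⇒∃[k]m≤k×k+n≡o {m} {n} {o} m+n≤o =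
  o ∸ n , m+n≤o⇒m≤o∸n m m+n≤o , m∸n+n≡m (≤-trans (m≤n+m n m) m+n≤o)

m<n⇒∃[o]0<o×m+o≡n : ∀ {m n} → m < n → ∃[ o ] 0 < o × m + o ≡ n
m<n⇒∃[o]0<o×m+o≡n {m} m<n with m≤n⇒∃[o]m+o≡n m<n
... | o , 1+m+o≡n = suc o , z<s , trans (+-suc m o) 1+m+o≡n

gcd[m,m+n]≡gcd[m,n] : ∀ m n → gcd m (m + n) ≡ gcd m n
gcd[m,m+n]≡gcd[m,n] m n = ∣-antisym
  (gcd-greatest (gcd[m,n]∣m m (m + n)) (∣m+n∣m⇒∣n (gcd[m,n]∣n m (m + n)) (gcd[m,n]∣m m (m + n))))
  (gcd-greatest (gcd[m,n]∣m m n) (∣m∣n⇒∣m+n (gcd[m,n]∣m m n) (gcd[m,n]∣n m n)))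

module _ {B : Set} (f : ℕ → B) where

  HasPeriodOn-restrict : ∀ {lo lo′ hi hi′ p} → lo ≤ lo′ → hi′ ≤ hi →
                         HasPeriodOn f lo hi p → HasPeriodOn f lo′ hi′ p
  HasPeriodOn-restrict lo≤lo′ hi′≤hi per k lo′≤k k+p<hi′ =
    per k (≤-trans lo≤lo′ lo′≤k) (<-≤-trans k+p<hi′ hi′≤hi)

  HasPeriodOn-cong : ∀ {g : ℕ → B} {lo hi p} → (∀ i → i < hi → f i ≡ g i) →
                     HasPeriodOn f lo hi p → HasPeriodOn g lo hi p
  HasPeriodOn-cong {p = p} f≗g per k lo≤k k+p<hi =
    trans (sym (f≗g k (≤-<-trans (m≤m+n k p) k+p<hi)))
      (trans (per k lo≤k k+p<hi) (f≗g (k + p) k+p<hi))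

  HasPeriodOn-suc : ∀ {lo hi p} → HasPeriodOn f (suc lo) (suc hi) p →
                    HasPeriodOn (λ i → f (suc i)) lo hi p
  HasPeriodOn-suc per k lo≤k k+p<hi = per (suc k) (s≤s lo≤k) (s≤s k+p<hi)

  HasPeriodOn-∪ : ∀ {lo lo′ hi hi′ p} → lo ≤ lo′ → lo′ + p ≤ hi →
                  HasPeriodOn f lo hi p → HasPeriodOn f lo′ hi′ p → HasPeriodOn f lo hi′ p
  HasPeriodOn-∪ {lo′ = lo′} {hi} {p = p} lo≤lo′ lo′+p≤hi per per′ k lo≤k k+p<hi′
    with k + p <? hi
  ... | yes k+p<hi = per k lo≤k k+p<hi
  ... | no  k+p≮hi = per′ k (+-cancelʳ-≤ p lo′ k (≤-trans lo′+p≤hi (≮⇒≥ k+p≮hi))) k+p<hi′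

  HasPeriodOn-difference : ∀ {lo hi} q e → lo + q + (q + e) ≤ hi →
                           HasPeriodOn f lo hi q → HasPeriodOn f lo hi (q + e) →
                           HasPeriodOn f lo hi e
  HasPeriodOn-difference {lo} {hi} q e long perq perqe k lo≤k k+e<hi
    with k + (q + e) <? hi
  ... | yes k+q+e<hi = begin
    f k             ≡⟨ perqe k lo≤k k+q+e<hi ⟩
    f (k + (q + e)) ≡⟨ cong f rearrange ⟩
    f (k + e + q)   ≡⟨ perq (k + e) (≤-trans lo≤k (m≤m+n k e))
                             (subst (_< hi) rearrange k+q+e<hi) ⟨
    f (k + e)       ∎
    where
    open ≡-Reasoning
    rearrange : k + (q + e) ≡ k + e + q
    rearrange = solve (k ∷ q ∷ e ∷ [])
  ... | no  k+q+e≮hi with m+n≤o⇒∃[k]m≤k×k+n≡o {n = q}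
                               (+-cancelʳ-≤ (q + e) (lo + q) k (≤-trans long (≮⇒≥ k+q+e≮hi)))
  ...   | m , lo≤m , refl = begin
    f (m + q)       ≡⟨ perq m lo≤m (≤-<-trans (m≤m+n (m + q) e) k+e<hi) ⟨
    f m             ≡⟨ perqe m lo≤m (subst (_< hi) (+-assoc m q e) k+e<hi) ⟩
    f (m + (q + e)) ≡⟨ cong f (+-assoc m q e) ⟨
    f (m + q + e)   ∎
    where open ≡-Reasoning

  fine-wilf : ∀ {lo hi} q r → lo + (q + r) ≤ hi →
              HasPeriodOn f lo hi q → HasPeriodOn f lo hi r → HasPeriodOn f lo hi (gcd q r)
  fine-wilf {lo} {hi} q r = go q r (<-wellFounded (q + r))
    where
    Per : ℕ → Set
    Per = HasPeriodOn f lo hi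
    rearrange : ∀ x y z → x + ((y + z) + y) ≡ x + y + (y + z)
    rearrange = solve-∀
    go : ∀ q r → Acc _<_ (q + r) → lo + (q + r) ≤ hi → Per q → Per r → Per (gcd q r)
    go zero r _ _ _ perr = subst Per (sym (gcd-identityˡ r)) perr
    go q@(suc _) zero _ _ perq _ = subst Per (sym (gcd-identityʳ q)) perq
    go q@(suc _) r@(suc _) (acc rs) long perq perr with ≤-total q r
    ... | inj₁ q≤r with m≤n⇒∃[o]m+o≡n q≤r
    ...   | e , refl = subst Per (sym (gcd[m,m+n]≡gcd[m,n] q e))
            (go q e (rs (+-monoʳ-< q (m<n+m e z<s)))
              (≤-trans (+-monoʳ-≤ lo (m≤n+m (q + e) q)) long) perq
              (HasPeriodOn-difference q e (subst (_≤ hi) (sym (+-assoc lo q (q + e))) long)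
                 perq perr))
    go q@(suc _) r@(suc _) (acc rs) long perq perr | inj₂ r≤q with m≤n⇒∃[o]m+o≡n r≤q
    ...   | e , refl = subst Per (sym (trans (gcd-comm (r + e) r) (gcd[m,m+n]≡gcd[m,n] r e)))
            (go r e (rs (m<m+n (r + e) z<s))
              (≤-trans (+-monoʳ-≤ lo (m≤m+n (r + e) r)) long) perr
              (HasPeriodOn-difference r e (subst (_≤ hi) (rearrange lo r e) long) perr perq))

  extend-periodʳ : ∀ {lo hi hi′ P γ} → 0 < P → lo + P + γ ≤ hi′ →
                   HasPeriodOn f lo hi P → HasPeriodOn f lo hi′ γ → HasPeriodOn f lo hi γ
  extend-periodʳ {lo} {hi} {hi′} {P} {γ} P>0 long perP perγ k = go (suc k) k (n<1+n k)
    where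
    go : ∀ t k → k < t → lo ≤ k → k + γ < hi → f k ≡ f (k + γ)
    go (suc t) k (s≤s k≤t) lo≤k k+γ<hi with k + γ <? hi′
    ... | yes k+γ<hi′ = perγ k lo≤k k+γ<hi′
    ... | no  k+γ≮hi′ with m+n≤o⇒∃[k]m≤k×k+n≡o {n = P}
                                 (+-cancelʳ-≤ γ (lo + P) k (≤-trans long (≮⇒≥ k+γ≮hi′)))
    ...   | m , lo≤m , refl = begin
      f (m + P)     ≡⟨ perP m lo≤m (≤-<-trans (m≤m+n (m + P) γ) k+γ<hi) ⟨
      f m           ≡⟨ go t m (<-≤-trans (m<m+n m P>0) k≤t) lo≤m
                         (≤-<-trans (+-monoˡ-≤ γ (m≤m+n m P)) k+γ<hi) ⟩
      f (m + γ)     ≡⟨ perP (m + γ) (≤-trans lo≤m (m≤m+n m γ)) (subst (_< hi) swap k+γ<hi) ⟩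
      f (m + γ + P) ≡⟨ cong f swap ⟨
      f (m + P + γ) ∎
      where
      open ≡-Reasoning
      swap : m + P + γ ≡ m + γ + P
      swap = solve (m ∷ P ∷ γ ∷ [])

  extend-periodˡ : ∀ {lo lo′ hi P γ} → 0 < P → lo′ + P + γ ≤ hi →
                   HasPeriodOn f lo hi P → HasPeriodOn f lo′ hi γ → HasPeriodOn f lo hi γ
  extend-periodˡ {lo} {lo′} {hi} {P} {γ} P>0 long perP perγ k = go lo′ k (m≤m+n lo′ k)
    where
    go : ∀ t k → lo′ ≤ t + k → lo ≤ k → k + γ < hi → f k ≡ f (k + γ)
    go t k _ lo≤k k+γ<hi with lo′ ≤? k
    ... | yes lo′≤k = perγ k lo′≤k k+γ<hi
    go zero    k lo′≤k _ _ | no lo′≰k = ⊥-elim (lo′≰k lo′≤k)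
    go (suc t) k lo′≤1+t+k lo≤k k+γ<hi | no lo′≰k = begin
      f k           ≡⟨ perP k lo≤k (≤-<-trans (m≤m+n (k + P) γ) k+P+γ<hi) ⟩
      f (k + P)     ≡⟨ go t (k + P) lo′≤t+[k+P] (≤-trans lo≤k (m≤m+n k P)) k+P+γ<hi ⟩
      f (k + P + γ) ≡⟨ cong f swap ⟩
      f (k + γ + P) ≡⟨ perP (k + γ) (≤-trans lo≤k (m≤m+n k γ)) (subst (_< hi) swap k+P+γ<hi) ⟨
      f (k + γ)     ∎
      where
      open ≡-Reasoning
      swap : k + P + γ ≡ k + γ + P
      swap = solve (k ∷ P ∷ γ ∷ [])
      k+P+γ<hi : k + P + γ < hi
      k+P+γ<hi = <-≤-trans (+-monoˡ-< γ (+-monoˡ-< P (≰⇒> lo′≰k))) long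
      lo′≤t+[k+P] : lo′ ≤ t + (k + P)
      lo′≤t+[k+P] = ≤-trans lo′≤1+t+k
        (≤-trans (≤-reflexive (sym (+-suc t k))) (+-monoʳ-≤ t (m<m+n k P>0)))

  extend-period : ∀ {lo lo′ hi hi′ P γ} → 0 < P → lo ≤ lo′ → hi′ ≤ hi → lo′ + P + γ ≤ hi′ →
                  HasPeriodOn f lo hi P → HasPeriodOn f lo′ hi′ γ → HasPeriodOn f lo hi γ
  extend-period P>0 lo≤lo′ hi′≤hi long perP perγ =
    extend-periodˡ P>0 (≤-trans long hi′≤hi) perP
      (extend-periodʳ P>0 long (HasPeriodOn-restrict lo≤lo′ ≤-refl perP) perγ)

  square-period-difference : ∀ {a e hi} → a + a + e ≤ hi →
                             HasPeriodOn f 0 (a + a) a → HasPeriodOn f 0 hi (a + e) →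
                             HasPeriodOn f a (a + a + e) e
  square-period-difference {a} {e} {hi} long pera perae k a≤k k+e<2a+e
    with m≤n⇒∃[o]m+o≡n a≤k
  ... | i , refl = begin
    f (a + i)       ≡⟨ cong f (+-comm a i) ⟩
    f (i + a)       ≡⟨ pera i z≤n (+-monoˡ-< a i<a) ⟨
    f i             ≡⟨ perae i z≤n (<-≤-trans (subst (_< a + a + e) rearrange k+e<2a+e) long) ⟩
    f (i + (a + e)) ≡⟨ cong f rearrange ⟨
    f (a + i + e)   ∎
    where
    open ≡-Reasoning
    i<a : i < a
    i<a = +-cancelˡ-< a i a (+-cancelʳ-< e (a + i) (a + a) k+e<2a+e)
    rearrange : a + i + e ≡ i + (a + e)
    rearrange = solve (a ∷ i ∷ e ∷ [])

  -- In the names below b = a + d, α = d + β, p = b + β, X = 2a + α and Y = 2b + β; the periods α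
  -- and β hold on [a, X) and [b, Y), so γ holds on [b, X), spreads to [a, Y) and then along p.
  three-squares-gcd-period : ∀ {a d β hi} → 0 < d → 0 < β → d + β ≤ a → a + d + (a + d) + β ≤ hi →
                             HasPeriodOn f 0 (a + a) a → HasPeriodOn f 0 (a + d + (a + d)) (a + d) →
                             HasPeriodOn f 0 hi (a + d + β) → HasPeriodOn f 0 hi (gcd (d + β) β)
  three-squares-gcd-period {a} {d} {β} {hi} d>0 β>0 d+β≤a long perA perB perP =
    extend-period (<-≤-trans β>0 (m≤n+m β (a + d))) z≤n long a+p+γ≤Y perP
      (HasPeriodOn-∪ (m≤m+n a d) b+γ≤X
        (extend-period (<-≤-trans d>0 (m≤m+n d β)) (m≤m+n a d) ≤-refl b+α+γ≤X perα perγ)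
        (extend-period β>0 ≤-refl X≤Y b+β+γ≤X perβ perγ))
    where
    γ : ℕ
    γ = gcd (d + β) β
    γ≤β : γ ≤ β
    γ≤β = gcd[m,n]≤n (d + β) β {{>-nonZero β>0}}
    γ≤d : γ ≤ d
    γ≤d = ∣⇒≤ {{>-nonZero d>0}}
            (∣m+n∣m⇒∣n (subst (γ ∣_) (+-comm d β) (gcd[m,n]∣m (d + β) β)) (gcd[m,n]∣n (d + β) β))
    X≤Y : a + a + (d + β) ≤ a + d + (a + d) + β
    X≤Y = ≤-trans (m≤m+n (a + a + (d + β)) d) (≤-reflexive (solve (a ∷ d ∷ β ∷ [])))
    b+α+β≤X : a + d + (d + β + β) ≤ a + a + (d + β)
    b+α+β≤X = begin
      a + d + (d + β + β)    ≡⟨ solve (a ∷ d ∷ β ∷ []) ⟩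
      d + β + (a + d + β)    ≤⟨ +-monoˡ-≤ (a + d + β) d+β≤a ⟩
      a + (a + d + β)        ≡⟨ solve (a ∷ d ∷ β ∷ []) ⟩
      a + a + (d + β)        ∎
      where open ≤-Reasoning
    b+α+γ≤X : a + d + (d + β) + γ ≤ a + a + (d + β)
    b+α+γ≤X = ≤-trans (+-monoʳ-≤ (a + d + (d + β)) γ≤β)
                (subst (_≤ a + a + (d + β)) (sym (+-assoc (a + d) (d + β) β)) b+α+β≤X)
    b+β+γ≤X : a + d + β + γ ≤ a + a + (d + β)
    b+β+γ≤X = ≤-trans (+-monoˡ-≤ γ (+-monoʳ-≤ (a + d) (m≤n+m β d))) b+α+γ≤X
    b+γ≤X : a + d + γ ≤ a + a + (d + β)
    b+γ≤X = ≤-trans (+-monoˡ-≤ γ (m≤m+n (a + d) β)) b+β+γ≤X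
    a+p+γ≤Y : a + (a + d + β) + γ ≤ a + d + (a + d) + β
    a+p+γ≤Y = begin
      a + (a + d + β) + γ    ≤⟨ +-monoʳ-≤ (a + (a + d + β)) γ≤d ⟩
      a + (a + d + β) + d    ≡⟨ solve (a ∷ d ∷ β ∷ []) ⟩
      a + d + (a + d) + β    ∎
      where open ≤-Reasoning
    perα : HasPeriodOn f a (a + a + (d + β)) (d + β)
    perα = square-period-difference (≤-trans X≤Y long) perA
           (subst (HasPeriodOn f 0 hi) (+-assoc a d β) perP)
    perβ : HasPeriodOn f (a + d) (a + d + (a + d) + β) β
    perβ = square-period-difference long perB perP
    perγ : HasPeriodOn f (a + d) (a + a + (d + β)) γ
    perγ = fine-wilf (d + β) β b+α+β≤X
           (HasPeriodOn-restrict (m≤m+n a d) ≤-refl perα) (HasPeriodOn-restrict ≤-refl X≤Y perβ)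

  -- The hypothesis p + p ≤ suc hi allows a square u u starting one position before f.
  three-squares-recurrence : ∀ {a b p hi} → a < b → b < p → p + p ≤ suc hi →
                             HasPeriodOn f 0 (a + a) a → HasPeriodOn f 0 (b + b) b →
                             HasPeriodOn f 0 hi p →
                             ∃[ s ] 0 < s × a + a + s ≤ hi × HasPeriodOn f 0 (a + a + s) s
  three-squares-recurrence {a} {b} {p} {hi} a<b b<p 2p≤1+hi perA perB perP with a + a <? p
  ... | yes 2a<p = p , ≤-<-trans z≤n b<p , 2a+p≤hi , HasPeriodOn-restrict ≤-refl 2a+p≤hi perP
    where
    2a+p≤hi : a + a + p ≤ hi
    2a+p≤hi = s≤s⁻¹ (<-≤-trans (+-monoˡ-< p 2a<p) 2p≤1+hi)
  ... | no 2a≮p with m<n⇒∃[o]0<o×m+o≡n a<b | m<n⇒∃[o]0<o×m+o≡n b<p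
  ...   | d , d>0 , refl | β , β>0 , refl =
    gcd (d + β) β , γ>0 , 2a+γ≤hi ,
    HasPeriodOn-restrict ≤-refl 2a+γ≤hi
      (three-squares-gcd-period d>0 β>0 d+β≤a 2b+β≤hi perA perB perP)
    where
    d+β≤a : d + β ≤ a
    d+β≤a = +-cancelˡ-≤ a (d + β) a (subst (_≤ a + a) (+-assoc a d β) (≮⇒≥ 2a≮p))
    2b+β≤hi : a + d + (a + d) + β ≤ hi
    2b+β≤hi = subst (_≤ hi) (sym (+-assoc (a + d) (a + d) β))
                (s≤s⁻¹ (<-≤-trans (+-monoˡ-< (a + d + β) b<p) 2p≤1+hi))
    γ>0 : 0 < gcd (d + β) β
    γ>0 = n≢0⇒n>0 (gcd[m,n]≢0 (d + β) β (inj₂ (n>0⇒n≢0 β>0)))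
    2a+γ≤hi : a + a + gcd (d + β) β ≤ hi
    2a+γ≤hi = ≤-trans (+-monoʳ-≤ (a + a) (gcd[m,n]≤n (d + β) β {{>-nonZero β>0}}))
                (≤-trans (+-monoˡ-≤ β (+-mono-≤ (m≤m+n a d) (m≤m+n a d))) 2b+β≤hi)

module _ {A : Set} where

  at : List A → ℕ → Maybe A
  at []       _       = nothing
  at (c ∷ _)  zero    = just c
  at (_ ∷ xs) (suc i) = at xs i

  at-++ˡ : ∀ (xs ys : List A) {i} → i < length xs → at (xs ++ ys) i ≡ at xs i
  at-++ˡ (_ ∷ _)  ys {zero}  _           = refl
  at-++ˡ (_ ∷ xs) ys {suc i} (s≤s i<|xs|) = at-++ˡ xs ys i<|xs|

  at-++ʳ : ∀ (xs ys : List A) i → at (xs ++ ys) (length xs + i) ≡ at ys i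
  at-++ʳ []       ys i = refl
  at-++ʳ (_ ∷ xs) ys i = at-++ʳ xs ys i

  at-take : ∀ n (xs : List A) {i} → i < n → at (take n xs) i ≡ at xs i
  at-take (suc n) []       _                = refl
  at-take (suc n) (_ ∷ _)  {zero}  _        = refl
  at-take (suc n) (_ ∷ xs) {suc i} (s≤s i<n) = at-take n xs i<n

  at-drop : ∀ k (xs : List A) i → at (drop k xs) i ≡ at xs (k + i)
  at-drop zero    xs       i = refl
  at-drop (suc k) []       i = refl
  at-drop (suc k) (_ ∷ xs) i = at-drop k xs i

  at-ext : ∀ (xs ys : List A) → length xs ≡ length ys →
           (∀ i → i < length xs → at xs i ≡ at ys i) → xs ≡ ys
  at-ext []       []       _      _     = refl
  at-ext (c ∷ xs) (e ∷ ys) |xs|≡|ys| agree =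
    cong₂ _∷_ (just-injective (agree 0 z<s))
      (at-ext xs ys (suc-injective |xs|≡|ys|) (λ i i<|xs| → agree (suc i) (s<s i<|xs|)))

  at-square-period : ∀ (r : List A) → HasPeriodOn (at (r ++ r)) 0 (length r + length r) (length r)
  at-square-period r i _ i+|r|<2|r| = begin
    at (r ++ r) i                ≡⟨ at-++ˡ r r (+-cancelʳ-< (length r) i (length r) i+|r|<2|r|) ⟩
    at r i                       ≡⟨ at-++ʳ r r i ⟨
    at (r ++ r) (length r + i)   ≡⟨ cong (at (r ++ r)) (+-comm (length r) i) ⟩
    at (r ++ r) (i + length r)   ∎
    where open ≡-Reasoning

  occurs⇒at : ∀ {x w : List A} {k} → OccursAt x w (suc k) →
              ∀ i → i < length x → at w (k + i) ≡ at x i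
  occurs⇒at {x} (_ , p , s , refl , refl) i i<|x| = trans (at-++ʳ p (x ++ s) i) (at-++ˡ x s i<|x|)

  occurs⇒≤length : ∀ {x w : List A} {k} → OccursAt x w (suc k) → k + length x ≤ length w
  occurs⇒≤length {x} (_ , p , s , refl , refl) = begin
    length p + length x                  ≤⟨ +-monoʳ-≤ (length p) (m≤m+n (length x) (length s)) ⟩
    length p + (length x + length s)     ≡⟨ cong (length p +_) (length-++ x) ⟨
    length p + length (x ++ s)           ≡⟨ length-++ p ⟨
    length (p ++ (x ++ s))               ∎
    where open ≤-Reasoning

  at⇒occurs : ∀ {x w : List A} {k} → k + length x ≤ length w →
              (∀ i → i < length x → at w (k + i) ≡ at x i) → OccursAt x w (suc k)
  at⇒occurs {x} {w} {k} fits agree = z<s , take k w , rest , |take|≡k , split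
    where
    |x|≤|drop| : length x ≤ length (drop k w)
    |x|≤|drop| = subst (length x ≤_) (sym (length-drop k w))
                   (m+n≤o⇒m≤o∸n (length x) (subst (_≤ length w) (+-comm k (length x)) fits))
    |take|≡k : length (take k w) ≡ k
    |take|≡k = trans (length-take k w) (m≤n⇒m⊓n≡m (≤-trans (m≤m+n k (length x)) fits))
    x′ rest : List A
    x′ = take (length x) (drop k w)
    rest = drop (length x) (drop k w)
    |x′|≡|x| : length x′ ≡ length x
    |x′|≡|x| = trans (length-take (length x) (drop k w)) (m≤n⇒m⊓n≡m |x|≤|drop|)
    x′≡x : x′ ≡ x
    x′≡x = at-ext x′ x |x′|≡|x| λ i i<|x′| →
      let i<|x| = subst (i <_) |x′|≡|x| i<|x′| in
      trans (at-take (length x) (drop k w) i<|x|) (trans (at-drop k w i) (agree i i<|x|))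
    split : w ≡ take k w ++ (x ++ rest)
    split = begin
      w                        ≡⟨ take++drop≡id k w ⟨
      take k w ++ drop k w     ≡⟨ cong (take k w ++_) (take++drop≡id (length x) (drop k w)) ⟨
      take k w ++ (x′ ++ rest) ≡⟨ cong (λ y → take k w ++ (y ++ rest)) x′≡x ⟩
      take k w ++ (x ++ rest)  ∎
      where open ≡-Reasoning

  occurs-unique : ∀ {x y w : List A} {k} → OccursAt x w (suc k) → OccursAt y w (suc k) →
                  length x ≡ length y → x ≡ y
  occurs-unique {x} {y} occx occy |x|≡|y| = at-ext x y |x|≡|y| λ i i<|x| →
    trans (sym (occurs⇒at occx i i<|x|)) (occurs⇒at occy i (subst (i <_) |x|≡|y| i<|x|))

  occurs-square-period : ∀ (r : List A) {w k} → OccursAt (r ++ r) w (suc k) →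
                         HasPeriodOn (λ i → at w (k + i)) 0 (length r + length r) (length r)
  occurs-square-period r occ = HasPeriodOn-cong (at (r ++ r))
    (λ i i<2|r| → sym (occurs⇒at occ i (subst (i <_) (sym (length-++ r)) i<2|r|)))
    (at-square-period r)

  occurs-shift : ∀ {x w : List A} {k s} → OccursAt x w (suc k) →
                 HasPeriodOn (λ i → at w (k + i)) 0 (length x + s) s →
                 k + s + length x ≤ length w → OccursAt x w (suc (k + s))
  occurs-shift {x} {w} {k} {s} occ per fits = at⇒occurs fits λ i i<|x| → begin
    at w (k + s + i)   ≡⟨ cong (at w) (solve (k ∷ s ∷ i ∷ [])) ⟩
    at w (k + (i + s)) ≡⟨ per i z≤n (+-monoˡ-< s i<|x|) ⟨
    at w (k + i)       ≡⟨ occurs⇒at occ i i<|x| ⟩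
    at x i             ∎
    where open ≡-Reasoning

  three-squares⇒later-occurrence : ∀ (u r t : List A) {w} → OccursAt (u ++ u) w 1 →
                                   OccursAt (r ++ r) w 2 → OccursAt (t ++ t) w 2 →
                                   length r < length t → length t < length u →
                                   ∃[ k ] 2 < k × OccursAt (r ++ r) w k
  three-squares⇒later-occurrence [] _ _ _ _ _ _ ()
  three-squares⇒later-occurrence u@(_ ∷ _) r t {w} occu occr occt r<t t<u
    with three-squares-recurrence (λ i → at w (suc i)) r<t t<u ≤-refl
           (occurs-square-period r occr) (occurs-square-period t occt)
           (HasPeriodOn-suc (at w)
             (HasPeriodOn-restrict (at w) z≤n ≤-refl (occurs-square-period u occu)))
  ... | s , s>0 , 2|r|+s≤hi , per =
    2 + s , s≤s (s≤s s>0) ,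
    occurs-shift occr (subst (λ n → HasPeriodOn _ 0 (n + s) s) (sym (length-++ r)) per) fits
    where
    fits : 1 + s + length (r ++ r) ≤ length w
    fits = begin
      suc (s + length (r ++ r))          ≡⟨ cong (λ n → suc (s + n)) (length-++ r) ⟩
      suc (s + (length r + length r))    ≡⟨ cong suc (+-comm s (length r + length r)) ⟩
      suc (length r + length r + s)      ≤⟨ s≤s 2|r|+s≤hi ⟩
      length u + length u                ≡⟨ length-++ u ⟨
      length (u ++ u)                    ≤⟨ occurs⇒≤length occu ⟩
      length w                           ∎
      where open ≤-Reasoning

  earlier-square-not-longer : ∀ (u r t : List A) {w} → OccursAt (u ++ u) w 1 →
                              LastOccursAt (r ++ r) w 2 → OccursAt (t ++ t) w 2 →
                              length r < length t → length u ≤ length t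
  earlier-square-not-longer u r t occu (occr , last) occt r<t = ≮⇒≥ λ t<u →
    let k , 2<k , occr′ = three-squares⇒later-occurrence u r t occu occr occt r<t t<u
    in last k 2<k occr′

  two-last-squares-bound : ∀ (u : List A) {w x y} → OccursAt (u ++ u) w 1 →
                           x ≢ y → Counted w 2 x → Counted w 2 y →
                           ∃[ v ] IsSquareWithRoot (v ++ v) v × LastOccursAt (v ++ v) w 2 ×
                                  length u ≤ length v
  two-last-squares-bound u occu x≢y ((r , r≢[] , refl) , lastr) ((t , t≢[] , refl) , lastt)
    with <-cmp (length r) (length t)
  ... | tri< r<t _ _ =
    t , (t≢[] , refl) , lastt , earlier-square-not-longer u r t occu lastr (proj₁ lastt) r<t
  ... | tri> _ _ t<r =
    r , (r≢[] , refl) , lastr , earlier-square-not-longer u t r occu lastt (proj₁ lastr) t<r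
  ... | tri≈ _ |r|≡|t| _ = ⊥-elim (x≢y (occurs-unique (proj₁ lastr) (proj₁ lastt) |rr|≡|tt|))
    where
    |rr|≡|tt| : length (r ++ r) ≡ length (t ++ t)
    |rr|≡|tt| = trans (length-++ r) (trans (cong₂ _+_ |r|≡|t| |r|≡|t|) (sym (length-++ t)))

lemma10 : {A : Set} (w : List A) → s≡2 w 1 → s≡2 w 2 →
    (u₁ u₂ : List A) → LongestRootAt w 1 u₁ → LongestRootAt w 2 u₂ →
    2 * length u₁ < 2 * length u₂ + 1
lemma10 w _ (x , y , x≢y , countedx , countedy , _) u₁ u₂
  ((_ , occ₁ , _) , _ , _) (_ , _ , longest₂)
  with two-last-squares-bound u₁ occ₁ x≢y countedx countedy
... | v , square , last , |u₁|≤|v| =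
  ≤-<-trans (*-monoʳ-≤ 2 (≤-trans |u₁|≤|v| (longest₂ v square last))) (m<m+n (2 * length u₂) z<s)
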